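{- Let $b=2^r+1$ for some nonnegative integer $r$. Then there exists a positive integer $n$ such that $n+2j$ is $b$-anti-Niven for all $0\leq j\leq b-1$; that is, the maximum length of a $b$-anti-Niven arithmetic progression with common difference $2$ is at least $b$.
   Context: For a positive integer $n$ with base-$b$ expansion $n=\sum_{j=0}^m a_jb^j$ ($0\leq a_j\leq b-1$), $s_b(n)=\sum_{j=0}^m a_j$. A positive integer $n$ is $b$-anti-Niven if $\gcd(n,s_b(n))=1$. -}

module Defs where

open import Data.Nat using (ℕ; zero; suc; _+_; _*_; _<_; _≤_; _^_; NonZero)
open import Data.Nat.DivMod using (_/_; _%_)
open import Data.Nat.GCD using (gcd)
open import Relation.Binary.PropositionalEquality using (_≡_)

digitSumAux : ℕ → (b : ℕ) → .{{NonZero b}} → ℕ → ℕ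
digitSumAux zero    b n = 0
digitSumAux (suc k) b n = n % b + digitSumAux k b (n / b)

-- s_b(n): the sum of the base-b digits of n (for b ≥ 2).
-- n has at most n base-b digits, so fuel n suffices.
s : (b : ℕ) → .{{NonZero b}} → ℕ → ℕ
s b n = digitSumAux n b n

AntiNiven : (b : ℕ) → .{{NonZero b}} → ℕ → Set
AntiNiven b n = (0 < n) × (gcd n (s b n) ≡ 1)
  where open import Data.Product using (_×_)

{-# OPTIONS --safe #-}
module Submission where

-- For b = 2k + 1 with k a power of 2, take n = b. Each b + 2j (0 ≤ j ≤ 2k) has two
-- base-b digits d + q b, with q = 1 for j ≤ k and q = 2 otherwise. Its digit sum is
-- d + q, and b + 2j = (d + q) + q (b - 1), so gcd(b + 2j, d + q) divides q (b - 1), a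
-- power of 2; as b + 2j is odd, the gcd is 1. The remaining base b = 2 is checked
-- directly.

open import Defs
open import Data.Nat using (ℕ; zero; suc; _+_; _*_; _<_; _≤_; _^_; s≤s; z≤n; NonZero; >-nonZero; >-nonZero⁻¹)
open import Data.Nat.Properties
open import Data.Nat.DivMod
open import Data.Nat.Divisibility
open import Data.Nat.Coprimality using (Coprime; coprime-factors; coprime⇒gcd≡1)
open import Data.Nat.Tactic.RingSolver using (solve-∀)
open import Data.Product using (Σ; _×_; _,_)
open import Relation.Binary.PropositionalEquality
open import Relation.Nullary using (yes; no)

coprime-^ : ∀ {m n} → Coprime m n → ∀ e → Coprime m (n ^ e)
coprime-^ cop zero    (_ , d∣1) = ∣1⇒≡1 d∣1
coprime-^ cop (suc e) (d∣m , d∣n*nᵉ) =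
  coprime-^ cop e (d∣m , coprime-factors cop (∣-trans d∣m (m∣m*n _) , d∣n*nᵉ))

odd-coprime-2 : ∀ t → Coprime (1 + 2 * t) 2
odd-coprime-2 t {d} (d∣odd , d∣2) =
  ∣1⇒≡1 (∣m+n∣m⇒∣n (subst (d ∣_) (+-comm 1 (2 * t)) d∣odd) (∣-trans d∣2 (m∣m*n t)))

odd-coprime-2^ : ∀ t e → Coprime (1 + 2 * t) (2 ^ e)
odd-coprime-2^ t = coprime-^ (odd-coprime-2 t)

coprime-summand : ∀ {n m k} → n ≡ m + k → Coprime n k → Coprime n m
coprime-summand {n} n≡m+k cop {d} (d∣n , d∣m) = cop (d∣n , ∣m+n∣m⇒∣n (subst (d ∣_) n≡m+k d∣n) d∣m)

module _ (b : ℕ) .{{_ : NonZero b}} where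

  digitSumAux-0 : ∀ F → digitSumAux F b 0 ≡ 0
  digitSumAux-0 zero    = refl
  digitSumAux-0 (suc F) =
    cong₂ _+_ (m<n⇒m%n≡m (>-nonZero⁻¹ b)) (trans (cong (digitSumAux F b) (0/n≡0 b)) (digitSumAux-0 F))

  digitSumAux-+* : ∀ F {d} x → d < b → digitSumAux (suc F) b (d + x * b) ≡ d + digitSumAux F b x
  digitSumAux-+* F {d} x d<b = cong₂ (λ u v → u + digitSumAux F b v) rem≡d quot≡x
    where
    rem≡d : (d + x * b) % b ≡ d
    rem≡d = trans ([m+kn]%n≡m%n d x b) (m<n⇒m%n≡m d<b)
    quot≡x : (d + x * b) / b ≡ x
    quot≡x = begin
      (d + x * b) / b      ≡⟨ +-distrib-/-∣ʳ d (n∣m*n x) ⟩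
      d / b + x * b / b    ≡⟨ cong₂ _+_ (m<n⇒m/n≡0 d<b) (m*n/n≡m x b) ⟩
      x                    ∎
      where open ≡-Reasoning

  digitSumAux-digit : ∀ F {d} → d < b → digitSumAux (suc F) b d ≡ d
  digitSumAux-digit F {d} d<b = begin
    digitSumAux (suc F) b d            ≡⟨ cong (digitSumAux (suc F) b) (sym (+-identityʳ d)) ⟩
    digitSumAux (suc F) b (d + 0 * b)  ≡⟨ digitSumAux-+* F 0 d<b ⟩
    d + digitSumAux F b 0              ≡⟨ cong (d +_) (digitSumAux-0 F) ⟩
    d + 0                              ≡⟨ +-identityʳ d ⟩
    d                                  ∎
    where open ≡-Reasoning

  digitSumAux-twoDigits : ∀ {F d q} → 2 ≤ F → d < b → q < b → digitSumAux F b (d + q * b) ≡ d + q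
  digitSumAux-twoDigits {suc (suc F)} {d} {q} (s≤s (s≤s _)) d<b q<b =
    trans (digitSumAux-+* (suc F) q d<b) (cong (d +_) (digitSumAux-digit F q<b))

antiNiven-twoDigits : ∀ c {d q} → d < suc c → 0 < q → q < suc c →
                      Coprime (d + q * suc c) (q * c) → AntiNiven (suc c) (d + q * suc c)
antiNiven-twoDigits c {d} {q} d<b 0<q q<b cop =
  <-≤-trans (s≤s z≤n) 2≤n , coprime⇒gcd≡1 (coprime-summand n≡ cop)
  where
  n = d + q * suc c
  -- s uses n itself as fuel, so reading two digits needs n ≥ 2.
  2≤n : 2 ≤ n
  2≤n = ≤-trans (s≤s (≤-trans 0<q (≤-pred q<b)))
                (≤-trans (m≤n*m (suc c) q {{>-nonZero 0<q}}) (m≤n+m _ d))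
  n≡ : n ≡ s (suc c) n + q * c
  n≡ = begin
    d + q * suc c       ≡⟨ cong (d +_) (*-suc q c) ⟩
    d + (q + q * c)     ≡⟨ sym (+-assoc d q (q * c)) ⟩
    d + q + q * c       ≡⟨ cong (_+ q * c) (sym (digitSumAux-twoDigits (suc c) 2≤n d<b q<b)) ⟩
    s (suc c) n + q * c ∎
    where open ≡-Reasoning

module _ (r : ℕ) where

  private
    k = 2 ^ r
    b = suc (2 * k)

    1≤k : 1 ≤ k
    1≤k = m^n>0 2 r

    2≤2k : 2 ≤ 2 * k
    2≤2k = *-monoʳ-≤ 2 1≤k

  antiNiven-lowerHalf : ∀ {j} → j ≤ k → AntiNiven b (b + 2 * j)
  antiNiven-lowerHalf {j} j≤k =
    subst (AntiNiven b) (digits≡ k j)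
      (antiNiven-twoDigits (2 * k) (s≤s (*-monoʳ-≤ 2 j≤k)) (s≤s z≤n) (s≤s (≤-trans (s≤s z≤n) 2≤2k)) coprime)
    where
    digits≡ : ∀ k j → 2 * j + 1 * suc (2 * k) ≡ suc (2 * k) + 2 * j
    digits≡ = solve-∀
    odd≡ : ∀ k j → 1 + 2 * (k + j) ≡ 2 * j + 1 * suc (2 * k)
    odd≡ = solve-∀
    coprime : Coprime (2 * j + 1 * b) (1 * (2 * k))
    coprime = subst₂ Coprime (odd≡ k j) (sym (*-identityˡ (2 * k))) (odd-coprime-2^ (k + j) (suc r))

  antiNiven-upperHalf : ∀ {i} → i < k → AntiNiven b (b + 2 * (suc k + i))
  antiNiven-upperHalf {i} i<k =
    subst (AntiNiven b) (digits≡ k i)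
      (antiNiven-twoDigits (2 * k) d<b (s≤s z≤n) (s≤s 2≤2k) coprime)
    where
    digits≡ : ∀ k i → (1 + 2 * i) + 2 * suc (2 * k) ≡ suc (2 * k) + 2 * (suc k + i)
    digits≡ = solve-∀
    odd≡ : ∀ k i → 1 + 2 * (i + suc (2 * k)) ≡ (1 + 2 * i) + 2 * suc (2 * k)
    odd≡ = solve-∀
    d<b : 1 + 2 * i < b
    d<b = s≤s (≤-trans (n≤1+n _) (subst (_≤ 2 * k) (*-suc 2 i) (*-monoʳ-≤ 2 i<k)))
    coprime : Coprime ((1 + 2 * i) + 2 * b) (2 * (2 * k))
    coprime = subst (λ n → Coprime n (2 ^ suc (suc r))) (odd≡ k i) (odd-coprime-2^ (i + b) (suc (suc r)))

  antiNiven-progression : ∀ j → j ≤ 2 * k → AntiNiven b (b + 2 * j)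
  antiNiven-progression j j≤2k with j ≤? k
  ... | yes j≤k = antiNiven-lowerHalf j≤k
  ... | no j≰k with m≤n⇒∃[o]m+o≡n (≰⇒> j≰k)
  ...   | i , refl = antiNiven-upperHalf (+-cancelˡ-≤ k (suc i) k
                       (subst₂ _≤_ (sym (+-suc k i)) (cong (k +_) (+-identityʳ k)) j≤2k))

theorem4p1 : (r : ℕ) →
    Σ ℕ (λ n → (0 < n) ×
      ((j : ℕ) → j ≤ 2 ^ r → AntiNiven (suc (2 ^ r)) (n + 2 * j)))
theorem4p1 zero = 2 , s≤s z≤n , antiNiven-base2
  where
  antiNiven-base2 : (j : ℕ) → j ≤ 1 → AntiNiven 2 (2 + 2 * j)
  antiNiven-base2 zero          _ = s≤s z≤n , refl
  antiNiven-base2 (suc zero)    _ = s≤s z≤n , refl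
  antiNiven-base2 (suc (suc j)) (s≤s ())
theorem4p1 (suc r) = suc (2 ^ suc r) , s≤s z≤n , antiNiven-progression r
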